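{- Let $(S,R)$ be a CRN and let $\mathcal{H}_1,\mathcal{H}_2$ be partitions of $S$ such that $\mathcal{H}_1$ is a refinement of $\mathcal{H}_2$. Then for all $X_i,X_j\in S$: (1) $X_i\sim^F_{\mathcal{H}_1}X_j$ implies $X_i\sim^F_{\mathcal{H}_2}X_j$; (2) $X_i\sim^B_{\mathcal{H}_1}X_j$ implies $X_i\sim^B_{\mathcal{H}_2}X_j$.
   Context: A CRN is a pair $(S,R)$ with $S$ a finite set of species and $R$ a finite set of reactions $\rho\xrightarrow{\alpha}\pi$, where $\rho,\pi$ are finite multisets over $S$, $\rho$ has at most two elements counted with multiplicity, and $\alpha>0$. $\rho(X)$ is the multiplicity of $X$ in $\rho$, $+$ is multiset union, $\mathcal{MS}(S)$ the set of finite multisets over $S$. Species are drawn from a universe well-ordered by $\sqsubseteq$; the choice function $\mu$ of a partition $\mathcal{H}$ maps $X$ to the $\sqsubseteq$-minimum of its block, lifted elementwise to multisets. Define $\mathbf{crr}[X,\rho]=(\rho(X)+1)\sum_{X+\rho\xrightarrow{\alpha}\pi\in R}\alpha$, $\mathbf{pr}(X,\rho,Y)=(\rho(X)+1)\sum_{X+\rho\xrightarrow{\alpha}\pi\in R}\alpha\,\pi(Y)$, $\mathbf{pr}[X,\rho,H]=\sum_{Y\in H}\mathbf{pr}(X,\rho,Y)$, $\mathbf{fr}(X,\rho)=\sum_{\rho\xrightarrow{\alpha}\pi\in R}(\pi(X)-\rho(X))\alpha$ (over reactions with reactant multiset exactly $\rho$), $\mathbf{fr}[X,\mathcal{M}]=\sum_{\rho\in\mathcal{M}}\mathbf{fr}(X,\rho)$,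 and $\rho\approx_{\mathcal{H}}\sigma$ iff $\mu(\rho)=\mu(\sigma)$ for $\mu$ the choice function of $\mathcal{H}$. $X\sim^F_{\mathcal{H}}Y$ iff $\mathbf{crr}[X,\rho]=\mathbf{crr}[Y,\rho]$ and $\mathbf{pr}[X,\rho,H]=\mathbf{pr}[Y,\rho,H]$ for all $\rho\in\mathcal{MS}(S)$, $H\in\mathcal{H}$; $X\sim^B_{\mathcal{H}}Y$ iff $\mathbf{fr}[X,\mathcal{M}]=\mathbf{fr}[Y,\mathcal{M}]$ for every $\approx_{\mathcal{H}}$-class $\mathcal{M}$ of $\{\rho\mid\rho\xrightarrow{\alpha}\pi\in R\}$. $\mathcal{H}_1$ refines $\mathcal{H}_2$ if every block of $\mathcal{H}_1$ is contained in a block of $\mathcal{H}_2$.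
   Formalization: The reaction rates α are positive rationals. -}

module Defs where

open import Data.Nat as ℕ using (ℕ; _≤_)
open import Data.Integer using (+_)
open import Data.Rational using (ℚ; 0ℚ; _+_; _*_; _-_; _/_; Positive)
open import Data.Fin using (Fin) renaming (_≟_ to _≟fin_)
open import Data.Fin.Properties using ()
open import Data.Vec as V using (Vec; lookup; tabulate; updateAt)
open import Data.Vec.Properties using (≡-dec)
open import Data.List as L using (List; []; _∷_; map; filter; allFin; deduplicate; foldr)
open import Data.List.Relation.Unary.All using (All)
open import Data.List.Relation.Unary.Unique.Propositional using (Unique)
open import Data.List.Membership.Propositional using (_∈_)
open import Data.Nat.ListAction using () renaming (sum to sumℕ)
open import Data.Bool using (if_then_else_)
open import Relation.Binary.PropositionalEquality using (_≡_)
open import Relation.Nullary.Decidable using (does; Dec)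
open import Data.Product using (_×_; Σ)

-- Species of a CRN with n species: Fin n, ordered by the (restriction of the
-- well-order ⊑ to S, which is) the usual order on Fin n.
-- Finite multisets over S: Vec ℕ n (multiplicity of each species).
MS : ℕ → Set
MS n = Vec ℕ n

_≟ms_ : ∀ {n} → (ρ σ : MS n) → Dec (ρ ≡ σ)
_≟ms_ = ≡-dec ℕ._≟_

mult : ∀ {n} → MS n → Fin n → ℕ
mult ρ X = lookup ρ X

size : ∀ {n} → MS n → ℕ
size ρ = V.sum ρ

addSp : ∀ {n} → Fin n → MS n → MS n
addSp X ρ = updateAt ρ X ℕ.suc

ℕ→ℚ : ℕ → ℚ
ℕ→ℚ k = + k / 1

Σℚ : List ℚ → ℚ
Σℚ = foldr _+_ 0ℚ

record Reaction (n : ℕ) : Set where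
  constructor _─[_]→_
  field
    reactant : MS n
    rate     : ℚ
    product  : MS n
open Reaction public

record CRN : Set where
  field
    n         : ℕ
    reactions : List (Reaction n)
    noDup     : Unique reactions
    atMostTwo : All (λ r → size (reactant r) ≤ 2) reactions
    ratePos   : All (λ r → Positive (rate r)) reactions
open CRN public

-- A partition 𝓗 of Fin n, given by a block-labelling function:
-- the blocks are the nonempty fibres  {Y | label Y ≡ label Z}.
record Partition (n : ℕ) : Set where
  field
    label : Fin n → ℕ
open Partition public

Block : ∀ {n} → Partition n → Fin n → Fin n → Set
Block 𝓗 Z Y = label 𝓗 Y ≡ label 𝓗 Z

Refines : ∀ {n} → Partition n → Partition n → Set
Refines {n} 𝓗₁ 𝓗₂ = ∀ (Z : Fin n) → Σ (Fin n) (λ W → ∀ Y → Block 𝓗₁ Z Y → Block 𝓗₂ W Y)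

-- choice function μ: X ↦ the minimum (w.r.t. the order of Fin n) of its block
μ : ∀ {n} → Partition n → Fin n → Fin n
μ {n} 𝓗 X = go (allFin n)
  where
  go : List (Fin n) → Fin n
  go []       = X
  go (Y ∷ ys) = if does (label 𝓗 Y ℕ.≟ label 𝓗 X) then Y else go ys

μMS : ∀ {n} → Partition n → MS n → MS n
μMS {n} 𝓗 ρ = tabulate λ Y →
  sumℕ (map (mult ρ) (filter (λ X → μ 𝓗 X ≟fin Y) (allFin n)))

_≈[_]_ : ∀ {n} → MS n → Partition n → MS n → Set
ρ ≈[ 𝓗 ] σ = μMS 𝓗 ρ ≡ μMS 𝓗 σ

module _ (C : CRN) where
  private
    N = n C
    R = reactions C

  withReactant : MS N → List (Reaction N)
  withReactant σ = filter (λ r → reactant r ≟ms σ) R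

  crr : Fin N → MS N → ℚ
  crr X ρ = ℕ→ℚ (ℕ.suc (mult ρ X)) * Σℚ (map rate (withReactant (addSp X ρ)))

  pr : Fin N → MS N → Fin N → ℚ
  pr X ρ Y = ℕ→ℚ (ℕ.suc (mult ρ X))
           * Σℚ (map (λ r → rate r * ℕ→ℚ (mult (product r) Y)) (withReactant (addSp X ρ)))

  -- pr[X,ρ,H] for H the block of Z in 𝓗
  prBlock : Partition N → Fin N → MS N → Fin N → ℚ
  prBlock 𝓗 X ρ Z =
    Σℚ (map (pr X ρ) (filter (λ Y → label 𝓗 Y ℕ.≟ label 𝓗 Z) (allFin N)))

  fr : Fin N → MS N → ℚ
  fr X ρ = Σℚ (map (λ r → (ℕ→ℚ (mult (product r) X) - ℕ→ℚ (mult (reactant r) X)) * rate r)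
                   (withReactant ρ))

  reactantSet : List (MS N)
  reactantSet = deduplicate _≟ms_ (map reactant R)

  classOf : Partition N → MS N → List (MS N)
  classOf 𝓗 ρ₀ = filter (λ ρ → μMS 𝓗 ρ ≟ms μMS 𝓗 ρ₀) reactantSet

  frClass : Fin N → List (MS N) → ℚ
  frClass X 𝓜 = Σℚ (map (fr X) 𝓜)

  FwdEquiv : Partition N → Fin N → Fin N → Set
  FwdEquiv 𝓗 X Y = ∀ (ρ : MS N) →
      crr X ρ ≡ crr Y ρ
    × (∀ (Z : Fin N) → prBlock 𝓗 X ρ Z ≡ prBlock 𝓗 Y ρ Z)

  -- backward equivalence X ∼^B_𝓗 Y
  -- (every ≈_𝓗-class 𝓜 of reactantSet is classOf 𝓗 ρ₀ for some ρ₀ ∈ reactantSet)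
  BwdEquiv : Partition N → Fin N → Fin N → Set
  BwdEquiv 𝓗 X Y = ∀ (ρ₀ : MS N) → ρ₀ ∈ reactantSet →
      frClass X (classOf 𝓗 ρ₀) ≡ frClass Y (classOf 𝓗 ρ₀)

-- When 𝓗₁ refines 𝓗₂, every 𝓗₂-block is a disjoint union of 𝓗₁-blocks,
-- and every ≈_𝓗₂-class a disjoint union of ≈_𝓗₁-classes, because μ₂(ρ) is obtained from
-- μ₁(ρ) by adding up the entries of each 𝓗₂-block. So every sum over a coarse block is a sum
-- of sums over fine blocks, and equality of the fine sums gives equality of the coarse ones;
-- crr does not depend on the partition at all.
module Submission where

open import Defs
open import Level using (Level)
open import Algebra.Bundles using (CommutativeMonoid)
open import Data.Bool using (if_then_else_)
open import Data.Fin using (Fin) renaming (_≟_ to _≟fin_)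
open import Data.List using (List; []; _∷_; map; filter; foldr; length; allFin)
open import Data.List.Properties using (filter-notAll)
open import Data.List.Relation.Unary.Any using (Any; here; there)
open import Data.List.Membership.Propositional using (_∈_; lose)
open import Data.List.Membership.Propositional.Properties using (∈-filter⁻; ∈-allFin)
open import Data.Nat as ℕ using (suc; _≤_; s≤s; s≤s⁻¹)
import Data.Nat.Properties as ℕ
import Data.Rational.Properties as ℚ
open import Data.Product using (_×_; _,_; proj₁; proj₂)
open import Data.Vec using (lookup)
open import Data.Vec.Properties using (lookup∘tabulate; tabulate-cong)
open import Function using (_∘_)
open import Relation.Nullary using (yes; no; ¬?; contradiction)
open import Relation.Nullary.Decidable using (does)
open import Relation.Unary using (Pred; Decidable; _⊆_; _≐_)
open import Relation.Binary.Definitions using (DecidableEquality)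
open import Relation.Binary.PropositionalEquality as ≡ using (_≡_)

private
  variable
    a p q : Level
    A K K₁ K₂ : Set a

filter-filter-⊆ : {P : Pred A p} {Q : Pred A q} (P? : Decidable P) (Q? : Decidable Q) →
                  P ⊆ Q → ∀ xs → filter P? (filter Q? xs) ≡ filter P? xs
filter-filter-⊆ P? Q? P⊆Q []       = ≡.refl
filter-filter-⊆ P? Q? P⊆Q (x ∷ xs) with Q? x
... | yes _ with P? x
...   | yes _ = ≡.cong (x ∷_) (filter-filter-⊆ P? Q? P⊆Q xs)
...   | no  _ = filter-filter-⊆ P? Q? P⊆Q xs
filter-filter-⊆ P? Q? P⊆Q (x ∷ xs) | no ¬Qx with P? x
...   | yes Px = contradiction (P⊆Q Px) ¬Qx
...   | no  _  = filter-filter-⊆ P? Q? P⊆Q xs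

findOr : {P : Pred A p} → Decidable P → A → List A → A
findOr P? d []       = d
findOr P? d (x ∷ xs) = if does (P? x) then x else findOr P? d xs

findOr-unique : {P : Pred A p} (P? : Decidable P) (d : A) (g : List A → A) → g [] ≡ d →
  (∀ x xs → g (x ∷ xs) ≡ (if does (P? x) then x else g xs)) →
  ∀ xs → g xs ≡ findOr P? d xs
findOr-unique P? d g g[] g∷ []       = g[]
findOr-unique P? d g g[] g∷ (x ∷ xs) rewrite g∷ x xs | findOr-unique P? d g g[] g∷ xs = ≡.refl

findOr-satisfies : {P : Pred A p} (P? : Decidable P) {d : A} → P d → ∀ xs → P (findOr P? d xs)
findOr-satisfies P? Pd []       = Pd
findOr-satisfies P? Pd (x ∷ xs) with P? x
... | yes Px = Px
... | no  _  = findOr-satisfies P? Pd xs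

findOr-cong : {P : Pred A p} {Q : Pred A q} (P? : Decidable P) (Q? : Decidable Q) → P ≐ Q →
  ∀ {d e xs} → Any P xs → findOr P? d xs ≡ findOr Q? e xs
findOr-cong P? Q? (P⊆Q , Q⊆P) {xs = x ∷ xs} Pxs with P? x | Q? x
... | yes _  | yes _  = ≡.refl
... | yes Px | no ¬Qx = contradiction (P⊆Q Px) ¬Qx
... | no ¬Px | yes Qx = contradiction (Q⊆P Qx) ¬Px
... | no ¬Px | no _   with Pxs
...   | here Px    = contradiction Px ¬Px
...   | there Pxs′ = findOr-cong P? Q? (P⊆Q , Q⊆P) Pxs′

fibre : DecidableEquality K → (A → K) → K → List A → List A
fibre _≟_ κ v = filter (λ x → κ x ≟ v)

module FibreSums {c ℓ} (M : CommutativeMonoid c ℓ) where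
  open CommutativeMonoid M
  open import Algebra.Properties.CommutativeSemigroup commutativeSemigroup using (x∙yz≈y∙xz)
  open import Relation.Binary.Reasoning.Setoid setoid

  sumOf : (A → Carrier) → List A → Carrier
  sumOf f xs = foldr _∙_ ε (map f xs)

  sumOf-filter-split : {P : Pred A p} (P? : Decidable P) (f : A → Carrier) → ∀ xs →
    sumOf f xs ≈ sumOf f (filter P? xs) ∙ sumOf f (filter (¬? ∘ P?) xs)
  sumOf-filter-split P? f []       = sym (identityˡ ε)
  sumOf-filter-split P? f (x ∷ xs) with P? x
  ... | yes _ = begin
    f x ∙ sumOf f xs                                                ≈⟨ ∙-congˡ (sumOf-filter-split P? f xs) ⟩
    f x ∙ (sumOf f (filter P? xs) ∙ sumOf f (filter (¬? ∘ P?) xs))  ≈⟨ assoc _ _ _ ⟨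
    (f x ∙ sumOf f (filter P? xs)) ∙ sumOf f (filter (¬? ∘ P?) xs)  ∎
  ... | no  _ = begin
    f x ∙ sumOf f xs                                                ≈⟨ ∙-congˡ (sumOf-filter-split P? f xs) ⟩
    f x ∙ (sumOf f (filter P? xs) ∙ sumOf f (filter (¬? ∘ P?) xs))  ≈⟨ x∙yz≈y∙xz _ _ _ ⟩
    sumOf f (filter P? xs) ∙ (f x ∙ sumOf f (filter (¬? ∘ P?) xs))  ∎

  sumOf-cong-fibres : (_≟_ : DecidableEquality K) (κ : A → K) (f g : A → Carrier) → ∀ xs →
    (∀ x → x ∈ xs → sumOf f (fibre _≟_ κ (κ x) xs) ≈ sumOf g (fibre _≟_ κ (κ x) xs)) →
    sumOf f xs ≈ sumOf g xs
  sumOf-cong-fibres {A = A} _≟_ κ f g xs = bounded (length xs) xs ℕ.≤-refl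
    where
    FibreSums≈ : List A → Set _
    FibreSums≈ ys = ∀ y → y ∈ ys → sumOf f (fibre _≟_ κ (κ y) ys) ≈ sumOf g (fibre _≟_ κ (κ y) ys)

    bounded : ∀ m xs → length xs ≤ m → FibreSums≈ xs → sumOf f xs ≈ sumOf g xs
    bounded _       []          _            _       = refl
    bounded (suc m) xs@(a ∷ as) (s≤s |as|≤m) fibres≈ = begin
      sumOf f xs                   ≈⟨ sumOf-filter-split sameAsA? f xs ⟩
      sumOf f atA ∙ sumOf f rest   ≈⟨ ∙-cong (fibres≈ a (here ≡.refl)) (bounded m rest |rest|≤m rest≈) ⟩
      sumOf g atA ∙ sumOf g rest   ≈⟨ sumOf-filter-split sameAsA? g xs ⟨
      sumOf g xs                   ∎
      where
      sameAsA? = λ x → κ x ≟ κ a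
      atA      = fibre _≟_ κ (κ a) xs
      rest     = filter (¬? ∘ sameAsA?) xs

      |rest|≤m : length rest ≤ m
      |rest|≤m = ℕ.≤-trans (s≤s⁻¹ (filter-notAll (¬? ∘ sameAsA?) xs (here (λ ne → ne ≡.refl)))) |as|≤m

      rest≈ : FibreSums≈ rest
      rest≈ c c∈rest = let (c∈xs , κc≢κa) = ∈-filter⁻ (¬? ∘ sameAsA?) c∈rest in
        ≡.subst (λ ys → sumOf f ys ≈ sumOf g ys)
          (≡.sym (filter-filter-⊆ (λ x → κ x ≟ κ c) (¬? ∘ sameAsA?)
                    (λ κx≡κc κx≡κa → κc≢κa (≡.trans (≡.sym κx≡κc) κx≡κa)) xs))
          (fibres≈ c c∈xs)

  sumOf-cong-coarserFibres :
    (_≟₁_ : DecidableEquality K₁) (_≟₂_ : DecidableEquality K₂) (κ₁ : A → K₁) (κ₂ : A → K₂) →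
    (∀ x y → κ₁ x ≡ κ₁ y → κ₂ x ≡ κ₂ y) → (f g : A → Carrier) → ∀ xs →
    (∀ x → x ∈ xs → sumOf f (fibre _≟₁_ κ₁ (κ₁ x) xs) ≈ sumOf g (fibre _≟₁_ κ₁ (κ₁ x) xs)) →
    ∀ v → sumOf f (fibre _≟₂_ κ₂ v xs) ≈ sumOf g (fibre _≟₂_ κ₂ v xs)
  sumOf-cong-coarserFibres _≟₁_ _≟₂_ κ₁ κ₂ κ₁-finer f g xs fineSums≈ v =
    sumOf-cong-fibres _≟₁_ κ₁ f g (fibre _≟₂_ κ₂ v xs) λ c c∈fibre →
      let (c∈xs , κ₂c≡v) = ∈-filter⁻ (λ x → κ₂ x ≟₂ v) c∈fibre in
      ≡.subst (λ ys → sumOf f ys ≈ sumOf g ys)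
        (≡.sym (filter-filter-⊆ (λ x → κ₁ x ≟₁ κ₁ c) (λ x → κ₂ x ≟₂ v)
                  (λ κ₁x≡κ₁c → ≡.trans (κ₁-finer _ c κ₁x≡κ₁c) κ₂c≡v) xs))
        (fineSums≈ c c∈xs)

module ℕΣ = FibreSums ℕ.+-0-commutativeMonoid
module ℚΣ = FibreSums ℚ.+-0-commutativeMonoid

module _ {n} (𝓗 : Partition n) where

  sameBlock? : (X : Fin n) → Decidable (Block 𝓗 X)
  sameBlock? X Y = label 𝓗 Y ℕ.≟ label 𝓗 X

  -- The worker of μ is local to its where-block; abstracting over allFin n exposes it,
  -- and its defining equations then identify it with findOr.
  μ≡findOr : ∀ X → μ 𝓗 X ≡ findOr (sameBlock? X) X (allFin n)
  μ≡findOr X with findOr-unique (sameBlock? X) X _ ≡.refl (λ _ _ → ≡.refl) | allFin n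
  ... | worker≡findOr | xs = worker≡findOr xs

  μ-sameBlock : ∀ X → Block 𝓗 X (μ 𝓗 X)
  μ-sameBlock X rewrite μ≡findOr X = findOr-satisfies (sameBlock? X) ≡.refl (allFin n)

  μ-cong : ∀ {X Y} → Block 𝓗 X Y → μ 𝓗 X ≡ μ 𝓗 Y
  μ-cong {X} {Y} Y∼X rewrite μ≡findOr X | μ≡findOr Y =
    findOr-cong (sameBlock? X) (sameBlock? Y)
      ((λ Z∼X → ≡.trans Z∼X (≡.sym Y∼X)) , (λ Z∼Y → ≡.trans Z∼Y Y∼X))
      (lose (∈-allFin X) ≡.refl)

  μ-reflects-block : ∀ {X Y} → μ 𝓗 X ≡ μ 𝓗 Y → Block 𝓗 X Y
  μ-reflects-block {X} {Y} μX≡μY =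
    ≡.trans (≡.sym (μ-sameBlock Y)) (≡.trans (≡.cong (label 𝓗) (≡.sym μX≡μY)) (μ-sameBlock X))

  lookup-μMS : ∀ ρ Y → lookup (μMS 𝓗 ρ) Y ≡ ℕΣ.sumOf (mult ρ) (fibre _≟fin_ (μ 𝓗) Y (allFin n))
  lookup-μMS ρ Y = lookup∘tabulate _ Y

module _ {n} {𝓗₁ 𝓗₂ : Partition n} (𝓗₁⊑𝓗₂ : Refines 𝓗₁ 𝓗₂) where

  refines⇒label-finer : ∀ X Y → label 𝓗₁ X ≡ label 𝓗₁ Y → label 𝓗₂ X ≡ label 𝓗₂ Y
  refines⇒label-finer X Y X∼₁Y =
    let block₁⊆block₂ = proj₂ (𝓗₁⊑𝓗₂ Y) in
    ≡.trans (block₁⊆block₂ X X∼₁Y) (≡.sym (block₁⊆block₂ Y ≡.refl))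

  refines⇒μ-finer : ∀ X Y → μ 𝓗₁ X ≡ μ 𝓗₁ Y → μ 𝓗₂ X ≡ μ 𝓗₂ Y
  refines⇒μ-finer X Y μ₁X≡μ₁Y = μ-cong 𝓗₂ (refines⇒label-finer Y X (μ-reflects-block 𝓗₁ μ₁X≡μ₁Y))

  refines⇒≈-finer : ∀ ρ σ → ρ ≈[ 𝓗₁ ] σ → ρ ≈[ 𝓗₂ ] σ
  refines⇒≈-finer ρ σ ρ≈₁σ = tabulate-cong
    (ℕΣ.sumOf-cong-coarserFibres _≟fin_ _≟fin_ (μ 𝓗₁) (μ 𝓗₂) refines⇒μ-finer (mult ρ) (mult σ)
      (allFin n) (λ X _ → fineSums≡ (μ 𝓗₁ X)))
    where
    open ≡.≡-Reasoning
    fineSums≡ : ∀ Z → ℕΣ.sumOf (mult ρ) (fibre _≟fin_ (μ 𝓗₁) Z (allFin n))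
                    ≡ ℕΣ.sumOf (mult σ) (fibre _≟fin_ (μ 𝓗₁) Z (allFin n))
    fineSums≡ Z = begin
      ℕΣ.sumOf (mult ρ) (fibre _≟fin_ (μ 𝓗₁) Z (allFin n))  ≡⟨ lookup-μMS 𝓗₁ ρ Z ⟨
      lookup (μMS 𝓗₁ ρ) Z                                   ≡⟨ ≡.cong (λ v → lookup v Z) ρ≈₁σ ⟩
      lookup (μMS 𝓗₁ σ) Z                                   ≡⟨ lookup-μMS 𝓗₁ σ Z ⟩
      ℕΣ.sumOf (mult σ) (fibre _≟fin_ (μ 𝓗₁) Z (allFin n))  ∎

module _ (C : CRN) {𝓗₁ 𝓗₂ : Partition (n C)} (𝓗₁⊑𝓗₂ : Refines 𝓗₁ 𝓗₂) {X Y : Fin (n C)} where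

  FwdEquiv-coarsen : FwdEquiv C 𝓗₁ X Y → FwdEquiv C 𝓗₂ X Y
  FwdEquiv-coarsen X∼Y ρ = proj₁ (X∼Y ρ) , λ Z →
    ℚΣ.sumOf-cong-coarserFibres ℕ._≟_ ℕ._≟_ (label 𝓗₁) (label 𝓗₂) (refines⇒label-finer 𝓗₁⊑𝓗₂)
      (pr C X ρ) (pr C Y ρ) (allFin (n C)) (λ W _ → proj₂ (X∼Y ρ) W) (label 𝓗₂ Z)

  BwdEquiv-coarsen : BwdEquiv C 𝓗₁ X Y → BwdEquiv C 𝓗₂ X Y
  BwdEquiv-coarsen X∼Y ρ₀ _ =
    ℚΣ.sumOf-cong-coarserFibres _≟ms_ _≟ms_ (μMS 𝓗₁) (μMS 𝓗₂) (refines⇒≈-finer 𝓗₁⊑𝓗₂)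
      (fr C X) (fr C Y) (reactantSet C) X∼Y (μMS 𝓗₂ ρ₀)

lemma32 : (C : CRN) (𝓗₁ 𝓗₂ : Partition (n C)) → Refines 𝓗₁ 𝓗₂ →
    (Xi Xj : Fin (n C)) →
      (FwdEquiv C 𝓗₁ Xi Xj → FwdEquiv C 𝓗₂ Xi Xj)
    × (BwdEquiv C 𝓗₁ Xi Xj → BwdEquiv C 𝓗₂ Xi Xj)
lemma32 C 𝓗₁ 𝓗₂ 𝓗₁⊑𝓗₂ Xi Xj = FwdEquiv-coarsen C 𝓗₁⊑𝓗₂ , BwdEquiv-coarsen C 𝓗₁⊑𝓗₂
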